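{- Let $n \geq d \geq 1$ be integers and let $x \in \mathbb{R}$. With the convention $j_0 = 0$, define $$f_{d,n}(x) := x^{n-d}\, d! \sum_{1\leq j_1<j_2<\cdots<j_d\leq n} x^{d-j_d} \prod_{r=0}^{d-1} \bigl(x-(d-r)\bigr)^{j_{r+1}-j_{r}-1}$$ and $$g_{d,n}(x) := \sum_{r=0}^d (-1)^r\binom{d}{r}(x-r)^n .$$ Then $f_{d,n}(x) = g_{d,n}(x)$.
   Context: The product $x^{n-d}\cdot x^{d-j_d}$ is understood as $x^{n-j_d}$ (note $n-j_d\ge 0$), so that $f_{d,n}$ is a polynomial in $x$; the convention $0^0=1$ is used. -}

module Defs where

open import Level using (Level)
open import Algebra.Bundles using (CommutativeRing)
open import Data.Nat as ℕ using (ℕ; zero; suc; _∸_; _!)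
open import Data.Nat.Combinatorics using (_C_)
open import Data.List using (List; []; _∷_; map; concatMap; upTo; [_])

range : ℕ → ℕ → List ℕ
range lo hi = map (lo ℕ.+_) (upTo (suc hi ∸ lo))

incLists : ℕ → ℕ → ℕ → List (List ℕ)
incLists zero    lo hi = [ [] ]
incLists (suc d) lo hi =
  concatMap (λ j → map (j ∷_) (incLists d (suc j) hi)) (range lo hi)

lastℕ : List ℕ → ℕ
lastℕ []           = 0
lastℕ (j ∷ [])     = j
lastℕ (_ ∷ k ∷ js) = lastℕ (k ∷ js)

module Poly {c ℓ : Level} (R : CommutativeRing c ℓ) where
  open CommutativeRing R

  cast : ℕ → Carrier
  cast zero    = 0#
  cast (suc n) = 1# + cast n

  _^_ : Carrier → ℕ → Carrier
  a ^ zero  = 1#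
  a ^ suc k = a * (a ^ k)

  sumL : List Carrier → Carrier
  sumL []       = 0#
  sumL (a ∷ as) = a + sumL as

  -- ∏_{r = r₀}^{...} (x - (d - r))^(j_{r+1} - j_r - 1), where prev = j_r
  -- and the remaining list is j_{r+1}, j_{r+2}, ...
  prodTerm : ℕ → Carrier → ℕ → ℕ → List ℕ → Carrier
  prodTerm d x r prev []       = 1#
  prodTerm d x r prev (j ∷ js) =
    ((x - cast (d ∸ r)) ^ (j ∸ prev ∸ 1)) * prodTerm d x (suc r) j js

  fTerm : ℕ → ℕ → Carrier → List ℕ → Carrier
  fTerm d n x js = (x ^ (n ∸ lastℕ js)) * prodTerm d x 0 0 js

  f : ℕ → ℕ → Carrier → Carrier
  f d n x = cast (d !) * sumL (map (fTerm d n x) (incLists d 1 n))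

  g : ℕ → ℕ → Carrier → Carrier
  g d n x = sumL (map (λ r → ((- 1#) ^ r) * (cast (d C r) * ((x - cast r) ^ n))) (range 0 d))

{-# OPTIONS --safe #-}

-- Both sides equal d! · h_{n-d}(x, x-1, …, x-d), where h_m is the complete
-- homogeneous symmetric polynomial of degree m.
--
-- For f: in the summand of (j₁ < … < j_d), the point x-(d-r) occurs with
-- multiplicity j_{r+1} - j_r - 1 and x with multiplicity n - j_d, so the sum
-- runs over all monomials of degree n-d in the d+1 points; splitting off j₁
-- reproduces the recursion h_m(p₀…p_k) = h_m(p₀…p_{k-1}) + p_k h_{m-1}(p₀…p_k).
--
-- For g: with p_i = x - i the divided-difference identity
--   (p₀ - p_{k+1}) h_m(p₀…p_{k+1}) = h_{m+1}(p₀…p_k) - h_{m+1}(p₁…p_{k+1})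
-- matches Pascal's rule g_{k+1,N}(x) = g_{k,N}(x) - g_{k,N}(x-1), and induction
-- on d gives d! h_{n-d}(p₀…p_d) = g_{d,n}(x).

module Submission where

open import Defs
open import Level using (Level)
open import Algebra.Bundles using (CommutativeRing)
open import Data.Nat using (ℕ; _≤_)

open import Data.Nat as ℕ using (zero; suc; _∸_; _!; _<_; s≤s)
import Data.Nat.Properties as ℕ
open import Data.Nat.Combinatorics using (_C_; nCk+nC[k+1]≡[n+1]C[k+1]; k>n⇒nCk≡0)
open import Data.List using (List; []; _∷_; map; concatMap; upTo; applyUpTo; _++_)
open import Data.List.Properties using (map-++; map-∘; map-cong; map-upTo)
open import Relation.Binary.PropositionalEquality as ≡ using (_≡_; cong)

module _ {c ℓ : Level} (R : CommutativeRing c ℓ) where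
  open CommutativeRing R
  open Poly R
  open import Algebra.Properties.Ring ring using (-0#≈0#; -‿+-comm; -1*x≈-x; x[y-z]≈xy-xz; [y-z]x≈yx-zx; -‿involutive)
  open import Algebra.Properties.CommutativeSemigroup +-commutativeSemigroup using (interchange)
  open import Algebra.Properties.CommutativeSemigroup *-commutativeSemigroup using (x∙yz≈y∙xz)
  open import Algebra.Properties.Semiring.Mult semiring using (_×_; ×-homo-+; ×1-homo-*)
  open import Relation.Binary.Reasoning.Setoid setoid

  ≡⇒≈ : ∀ {a b} → a ≡ b → a ≈ b
  ≡⇒≈ ≡.refl = refl

  x-0#≈x : ∀ x → x - 0# ≈ x
  x-0#≈x x = trans (+-congˡ -0#≈0#) (+-identityʳ x)

  x-[y+z]≈[x-y]-z : ∀ x y z → x - (y + z) ≈ (x - y) - z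
  x-[y+z]≈[x-y]-z x y z = trans (+-congˡ (sym (-‿+-comm y z))) (sym (+-assoc x (- y) (- z)))

  [x-y]+[z-w]≈[x+z]-[y+w] : ∀ x y z w → (x - y) + (z - w) ≈ (x + z) - (y + w)
  [x-y]+[z-w]≈[x+z]-[y+w] x y z w = trans (interchange x (- y) z (- w)) (+-congˡ (-‿+-comm y w))

  [x+z]-[y+z]≈x-y : ∀ x y z → (x + z) - (y + z) ≈ x - y
  [x+z]-[y+z]≈x-y x y z = begin
    (x + z) - (y + z)    ≈⟨ sym ([x-y]+[z-w]≈[x+z]-[y+w] x y z z) ⟩
    (x - y) + (z - z)    ≈⟨ +-congˡ (-‿inverseʳ z) ⟩
    (x - y) + 0#         ≈⟨ +-identityʳ _ ⟩
    x - y                ∎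

  y+u≈x+v⇒u-v≈x-y : ∀ {x y u v} → y + u ≈ x + v → u - v ≈ x - y
  y+u≈x+v⇒u-v≈x-y {x} {y} {u} {v} e = begin
    u - v                ≈⟨ sym ([x+z]-[y+z]≈x-y u v y) ⟩
    (u + y) - (v + y)    ≈⟨ +-cong (+-comm u y) (-‿cong (+-comm v y)) ⟩
    (y + u) - (y + v)    ≈⟨ +-congʳ e ⟩
    (x + v) - (y + v)    ≈⟨ [x+z]-[y+z]≈x-y x y v ⟩
    x - y                ∎

  [x-0#]-[x-y]≈y : ∀ x y → (x - 0#) - (x - y) ≈ y
  [x-0#]-[x-y]≈y x y = begin
    (x - 0#) - (x - y)   ≈⟨ +-cong (x-0#≈x x) (sym (-‿+-comm x (- y))) ⟩
    x + (- x + - - y)    ≈⟨ sym (+-assoc x (- x) (- - y)) ⟩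
    (x - x) + - - y      ≈⟨ +-cong (-‿inverseʳ x) (-‿involutive y) ⟩
    0# + y               ≈⟨ +-identityˡ y ⟩
    y                    ∎

  cast≈×1# : ∀ n → cast n ≈ n × 1#
  cast≈×1# zero    = refl
  cast≈×1# (suc n) = +-congˡ (cast≈×1# n)

  cast-+ : ∀ m n → cast (m ℕ.+ n) ≈ cast m + cast n
  cast-+ m n = trans (cast≈×1# (m ℕ.+ n))
    (trans (×-homo-+ 1# m n) (sym (+-cong (cast≈×1# m) (cast≈×1# n))))

  cast-* : ∀ m n → cast (m ℕ.* n) ≈ cast m * cast n
  cast-* m n = trans (cast≈×1# (m ℕ.* n))
    (trans (×1-homo-* m n) (sym (*-cong (cast≈×1# m) (cast≈×1# n))))

  ^-congˡ : ∀ {a b} → a ≈ b → ∀ k → a ^ k ≈ b ^ k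
  ^-congˡ e zero    = refl
  ^-congˡ e (suc k) = *-cong e (^-congˡ e k)

  sumL-map-cong : ∀ {A : Set} {F G : A → Carrier} (l : List A) →
                  (∀ a → F a ≈ G a) → sumL (map F l) ≈ sumL (map G l)
  sumL-map-cong []      e = refl
  sumL-map-cong (a ∷ l) e = +-cong (e a) (sumL-map-cong l e)

  sumL-++ : ∀ as bs → sumL (as ++ bs) ≈ sumL as + sumL bs
  sumL-++ []       bs = sym (+-identityˡ _)
  sumL-++ (a ∷ as) bs = trans (+-congˡ (sumL-++ as bs)) (sym (+-assoc _ _ _))

  *-distribˡ-sumL : ∀ {A : Set} a (F : A → Carrier) (l : List A) →
                    a * sumL (map F l) ≈ sumL (map (λ z → a * F z) l)
  *-distribˡ-sumL a F []      = zeroʳ a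
  *-distribˡ-sumL a F (z ∷ l) = trans (distribˡ a _ _) (+-congˡ (*-distribˡ-sumL a F l))

  sumL-concatMap : ∀ {A B : Set} (F : B → Carrier) (G : A → List B) (l : List A) →
    sumL (map F (concatMap G l)) ≈ sumL (map (λ a → sumL (map F (G a))) l)
  sumL-concatMap F G []      = refl
  sumL-concatMap F G (a ∷ l) = begin
    sumL (map F (G a ++ concatMap G l))                ≡⟨ cong sumL (map-++ F (G a) (concatMap G l)) ⟩
    sumL (map F (G a) ++ map F (concatMap G l))        ≈⟨ sumL-++ (map F (G a)) _ ⟩
    sumL (map F (G a)) + sumL (map F (concatMap G l))  ≈⟨ +-congˡ (sumL-concatMap F G l) ⟩
    _                                                  ∎

  sumTo : (ℕ → Carrier) → ℕ → Carrier
  sumTo F c = sumL (applyUpTo F c)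

  sumL-map-range : ∀ (F : ℕ → Carrier) lo hi →
                   sumL (map F (range lo hi)) ≡ sumTo (λ i → F (lo ℕ.+ i)) (suc hi ∸ lo)
  sumL-map-range F lo hi = cong sumL (≡.trans (≡.sym (map-∘ (upTo (suc hi ∸ lo)))) (map-upTo _ _))

  *-distribˡ-sumTo : ∀ a (F : ℕ → Carrier) c → a * sumTo F c ≈ sumTo (λ i → a * F i) c
  *-distribˡ-sumTo a F zero    = zeroʳ a
  *-distribˡ-sumTo a F (suc c) = trans (distribˡ a _ _) (+-congˡ (*-distribˡ-sumTo a (λ i → F (suc i)) c))

  sumTo-cong : ∀ {F G : ℕ → Carrier} c → (∀ i → F i ≈ G i) → sumTo F c ≈ sumTo G c
  sumTo-cong zero    e = refl
  sumTo-cong (suc c) e = +-cong (e 0) (sumTo-cong c (λ i → e (suc i)))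

  sumTo-0# : ∀ {F : ℕ → Carrier} c → (∀ i → F i ≈ 0#) → sumTo F c ≈ 0#
  sumTo-0# zero    e = refl
  sumTo-0# (suc c) e = trans (+-cong (e 0) (sumTo-0# c (λ i → e (suc i)))) (+-identityˡ 0#)

  sumTo-distrib-sub : ∀ (F G : ℕ → Carrier) c → sumTo (λ i → F i - G i) c ≈ sumTo F c - sumTo G c
  sumTo-distrib-sub F G zero    = sym (x-0#≈x 0#)
  sumTo-distrib-sub F G (suc c) = trans (+-congˡ (sumTo-distrib-sub (λ i → F (suc i)) (λ i → G (suc i)) c))
                              ([x-y]+[z-w]≈[x+z]-[y+w] (F 0) (G 0) _ _)

  sumTo-suc : ∀ (F : ℕ → Carrier) c → sumTo F (suc c) ≈ sumTo F c + F c
  sumTo-suc F zero    = trans (+-identityʳ _) (sym (+-identityˡ _))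
  sumTo-suc F (suc c) = trans (+-congˡ (sumTo-suc (λ i → F (suc i)) c)) (sym (+-assoc _ _ _))

  -- complete p k m = h_m(p 0, …, p (k-1)), split by whether p 0 occurs in the monomial
  complete : (ℕ → Carrier) → ℕ → ℕ → Carrier
  complete p zero    zero    = 1#
  complete p zero    (suc m) = 0#
  complete p (suc k) zero    = 1#
  complete p (suc k) (suc m) = complete (λ i → p (suc i)) k (suc m) + p 0 * complete p (suc k) m

  complete-cong : ∀ {p q : ℕ → Carrier} k m → (∀ i → p i ≈ q i) → complete p k m ≈ complete q k m
  complete-cong zero    zero    e = refl
  complete-cong zero    (suc m) e = refl
  complete-cong (suc k) zero    e = refl
  complete-cong (suc k) (suc m) e =
    +-cong (complete-cong k (suc m) (λ i → e (suc i))) (*-cong (e 0) (complete-cong (suc k) m e))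

  complete-1 : ∀ p m → complete p 1 m ≈ p 0 ^ m
  complete-1 p zero    = refl
  complete-1 p (suc m) = trans (+-identityˡ _) (*-congˡ (complete-1 p m))

  complete-last : ∀ p k m →
    complete p (suc k) (suc m) ≈ complete p k (suc m) + p k * complete p (suc k) m
  complete-last p zero    m = refl
  complete-last p (suc k) zero = begin
    complete p′ (suc k) 1 + p 0 * 1#                 ≈⟨ +-congʳ (complete-last p′ k 0) ⟩
    (complete p′ k 1 + p (suc k) * 1#) + p 0 * 1#    ≈⟨ +-assoc _ _ _ ⟩
    complete p′ k 1 + (p (suc k) * 1# + p 0 * 1#)    ≈⟨ +-congˡ (+-comm _ _) ⟩
    complete p′ k 1 + (p 0 * 1# + p (suc k) * 1#)    ≈⟨ sym (+-assoc _ _ _) ⟩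
    (complete p′ k 1 + p 0 * 1#) + p (suc k) * 1#    ∎
    where p′ = λ i → p (suc i)
  complete-last p (suc k) (suc m) = begin
    complete p′ (suc k) (suc (suc m)) + p 0 * V  ≈⟨ +-cong (complete-last p′ k (suc m)) (*-congˡ (complete-last p (suc k) m)) ⟩
    (A + P * B) + p 0 * (U + P * W)              ≈⟨ +-congˡ (distribˡ (p 0) U (P * W)) ⟩
    (A + P * B) + (p 0 * U + p 0 * (P * W))      ≈⟨ interchange A (P * B) (p 0 * U) _ ⟩
    (A + p 0 * U) + (P * B + p 0 * (P * W))      ≈⟨ +-congˡ (+-congˡ (x∙yz≈y∙xz (p 0) P W)) ⟩
    (A + p 0 * U) + (P * B + P * (p 0 * W))      ≈⟨ +-congˡ (sym (distribˡ P B (p 0 * W))) ⟩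
    (A + p 0 * U) + P * V                        ∎
    where
    p′ = λ i → p (suc i)
    P = p (suc k)
    A = complete p′ k (suc (suc m))
    B = complete p′ (suc k) (suc m)
    U = complete p (suc k) (suc m)
    W = complete p (suc (suc k)) m
    V = complete p (suc (suc k)) (suc m)

  complete-divided-difference : ∀ p k m →
    (p 0 - p (suc k)) * complete p (suc (suc k)) m
      ≈ complete p (suc k) (suc m) - complete (λ i → p (suc i)) (suc k) (suc m)
  complete-divided-difference p k m =
    trans ([y-z]x≈yx-zx _ (p 0) (p (suc k))) (y+u≈x+v⇒u-v≈x-y (complete-last p (suc k) m))

  gTerm : ℕ → ℕ → Carrier → ℕ → Carrier
  gTerm k N y r = ((- 1#) ^ r) * (cast (k C r) * ((y - cast r) ^ N))

  g≡sumTo : ∀ k N y → g k N y ≡ sumTo (gTerm k N y) (suc k)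
  g≡sumTo k N y = sumL-map-range (gTerm k N y) 0 k

  g-pascal : ∀ k N y → g (suc k) N y ≈ g k N y - g k N (y - 1#)
  g-pascal k N y = begin
    g (suc k) N y                                     ≡⟨ g≡sumTo (suc k) N y ⟩
    B 0 + sumTo (λ s → B (suc s)) (suc k)             ≈⟨ +-congˡ (sumTo-cong (suc k) B[1+s]≈A[1+s]-A′s) ⟩
    A 0 + sumTo (λ s → A (suc s) - A′ s) (suc k)      ≈⟨ +-congˡ (sumTo-distrib-sub (λ s → A (suc s)) A′ (suc k)) ⟩
    A 0 + (sumTo (λ s → A (suc s)) (suc k) - sumTo A′ (suc k))
                                                      ≈⟨ sym (+-assoc _ _ _) ⟩
    sumTo A (suc (suc k)) - sumTo A′ (suc k)          ≈⟨ +-congʳ (sumTo-suc A (suc k)) ⟩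
    (sumTo A (suc k) + A (suc k)) - sumTo A′ (suc k)  ≈⟨ +-congʳ (trans (+-congˡ A[1+k]≈0#) (+-identityʳ _)) ⟩
    sumTo A (suc k) - sumTo A′ (suc k)                ≡⟨ ≡.sym (≡.cong₂ _-_ (g≡sumTo k N y) (g≡sumTo k N (y - 1#))) ⟩
    g k N y - g k N (y - 1#)                          ∎
    where
    A = gTerm k N y
    A′ = gTerm k N (y - 1#)
    B = gTerm (suc k) N y
    A[1+k]≈0# : A (suc k) ≈ 0#
    A[1+k]≈0# = begin
      ((- 1#) ^ suc k) * (cast (k C suc k) * Z)  ≡⟨ cong (λ t → ((- 1#) ^ suc k) * (cast t * Z)) (k>n⇒nCk≡0 (ℕ.n<1+n k)) ⟩
      ((- 1#) ^ suc k) * (0# * Z)                ≈⟨ *-congˡ (zeroˡ Z) ⟩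
      ((- 1#) ^ suc k) * 0#                      ≈⟨ zeroʳ _ ⟩
      0#                                         ∎
      where Z = (y - cast (suc k)) ^ N
    B[1+s]≈A[1+s]-A′s : ∀ s → B (suc s) ≈ A (suc s) - A′ s
    B[1+s]≈A[1+s]-A′s s = begin
      (- 1# * e) * (cast (suc k C suc s) * Z)
          ≈⟨ *-congˡ (*-congʳ (trans (≡⇒≈ (cong cast (≡.sym (nCk+nC[k+1]≡[n+1]C[k+1] k s)))) (cast-+ (k C s) (k C suc s)))) ⟩
      (- 1# * e) * ((cA + cB) * Z)                      ≈⟨ *-congˡ (distribʳ Z cA cB) ⟩
      (- 1# * e) * (cA * Z + cB * Z)                    ≈⟨ distribˡ _ _ _ ⟩
      (- 1# * e) * (cA * Z) + (- 1# * e) * (cB * Z)     ≈⟨ +-comm _ _ ⟩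
      (- 1# * e) * (cB * Z) + (- 1# * e) * (cA * Z)     ≈⟨ +-congˡ (trans (*-assoc _ _ _) (-1*x≈-x _)) ⟩
      A (suc s) - e * (cA * Z)                          ≈⟨ +-congˡ (-‿cong (*-congˡ (*-congˡ (^-congˡ (x-[y+z]≈[x-y]-z y 1# (cast s)) N)))) ⟩
      A (suc s) - A′ s                                  ∎
      where
      e = (- 1#) ^ s
      Z = (y - cast (suc s)) ^ N
      cA = cast (k C s)
      cB = cast (k C suc s)

  points : Carrier → ℕ → Carrier
  points y i = y - cast i

  factorial*complete≈g : ∀ k m y → cast (k !) * complete (points y) (suc k) m ≈ g k (m ℕ.+ k) y
  factorial*complete≈g zero m y rewrite ℕ.+-identityʳ m =
    trans (*-congˡ (complete-1 (points y) m)) (trans (sym (*-identityˡ _)) (sym (+-identityʳ _)))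
  factorial*complete≈g (suc k) m y rewrite ℕ.+-suc m k = begin
    cast (suc k ℕ.* k !) * H                             ≈⟨ *-congʳ (trans (cast-* (suc k) (k !)) (*-comm _ _)) ⟩
    (cast (k !) * cast (suc k)) * H                      ≈⟨ *-assoc _ _ _ ⟩
    cast (k !) * (cast (suc k) * H)                      ≈⟨ *-congˡ (*-congʳ (sym ([x-0#]-[x-y]≈y y (cast (suc k))))) ⟩
    cast (k !) * ((points y 0 - points y (suc k)) * H)   ≈⟨ *-congˡ (complete-divided-difference (points y) k m) ⟩
    cast (k !) * (X - Y)                                 ≈⟨ *-congˡ (+-congˡ (-‿cong Y≈Y′)) ⟩
    cast (k !) * (X - Y′)                                ≈⟨ x[y-z]≈xy-xz _ _ _ ⟩
    cast (k !) * X - cast (k !) * Y′                     ≈⟨ +-cong (factorial*complete≈g k (suc m) y) (-‿cong (factorial*complete≈g k (suc m) (y - 1#))) ⟩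
    g k (suc m ℕ.+ k) y - g k (suc m ℕ.+ k) (y - 1#)     ≈⟨ sym (g-pascal k (suc m ℕ.+ k) y) ⟩
    g (suc k) (suc (m ℕ.+ k)) y                          ∎
    where
    H = complete (points y) (suc (suc k)) m
    X = complete (points y) (suc k) (suc m)
    Y = complete (λ i → points y (suc i)) (suc k) (suc m)
    Y′ = complete (points (y - 1#)) (suc k) (suc m)
    Y≈Y′ : Y ≈ Y′
    Y≈Y′ = complete-cong (suc k) (suc m) (λ i → x-[y+z]≈[x-y]-z y 1# (cast i))

  lastOr : ℕ → List ℕ → ℕ
  lastOr a []       = a
  lastOr a (j ∷ js) = lastOr j js

  lastℕ≡lastOr : ∀ j js → lastℕ (j ∷ js) ≡ lastOr j js
  lastℕ≡lastOr j []       = ≡.refl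
  lastℕ≡lastOr j (k ∷ js) = lastℕ≡lastOr k js

  m<n⇒n∸m≡1+[n∸1+m] : ∀ {m n} → m < n → n ∸ m ≡ suc (n ∸ suc m)
  m<n⇒n∸m≡1+[n∸1+m] (s≤s m≤n) = ℕ.+-∸-assoc 1 m≤n

  [1+m+n]∸m∸1≡n : ∀ m n → suc m ℕ.+ n ∸ m ∸ 1 ≡ n
  [1+m+n]∸m∸1≡n zero    n = ≡.refl
  [1+m+n]∸m∸1≡n (suc m) n = [1+m+n]∸m∸1≡n m n

  module _ (d n : ℕ) (x : Carrier) where

    factor : ℕ → Carrier
    factor r = x - cast (d ∸ r)

    -- the summand of f for a tail j_{r+1} < j_{r+2} < … following j_r = prev
    summand : ℕ → ℕ → List ℕ → Carrier
    summand prev r js = (x ^ (n ∸ lastOr prev js)) * prodTerm d x r prev js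

    incSum : ℕ → ℕ → ℕ → Carrier
    incSum k prev r = sumL (map (summand prev r) (incLists k (suc prev) n))

    incSum-suc : ∀ k prev r →
      incSum (suc k) prev r ≈ sumTo (λ i → (factor r ^ i) * incSum k (suc prev ℕ.+ i) (suc r)) (n ∸ prev)
    incSum-suc k prev r = begin
      incSum (suc k) prev r                                              ≈⟨ sumL-concatMap (summand prev r) _ (range (suc prev) n) ⟩
      sumL (map (λ j → sumL (map (summand prev r) (map (j ∷_) (tails j)))) (range (suc prev) n))
                                                                         ≈⟨ sumL-map-cong (range (suc prev) n) split-first ⟩
      sumL (map (λ j → (factor r ^ (j ∸ prev ∸ 1)) * incSum k j (suc r)) (range (suc prev) n))
                                                                         ≡⟨ sumL-map-range _ (suc prev) n ⟩
      sumTo (λ i → (factor r ^ (suc prev ℕ.+ i ∸ prev ∸ 1)) * incSum k (suc prev ℕ.+ i) (suc r)) (n ∸ prev)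
                                                                         ≈⟨ sumTo-cong (n ∸ prev) drop-offset ⟩
      sumTo (λ i → (factor r ^ i) * incSum k (suc prev ℕ.+ i) (suc r)) (n ∸ prev) ∎
      where
      tails : ℕ → List (List ℕ)
      tails j = incLists k (suc j) n
      split-first : ∀ j → sumL (map (summand prev r) (map (j ∷_) (tails j)))
                          ≈ (factor r ^ (j ∸ prev ∸ 1)) * incSum k j (suc r)
      split-first j = begin
        sumL (map (summand prev r) (map (j ∷_) (tails j)))  ≡⟨ cong sumL (≡.sym (map-∘ (tails j))) ⟩
        sumL (map (λ js → summand prev r (j ∷ js)) (tails j))
                                                           ≈⟨ sumL-map-cong (tails j) (λ js → x∙yz≈y∙xz _ _ _) ⟩
        sumL (map (λ js → (factor r ^ (j ∸ prev ∸ 1)) * summand j (suc r) js) (tails j))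
                                                           ≈⟨ sym (*-distribˡ-sumL _ (summand j (suc r)) (tails j)) ⟩
        (factor r ^ (j ∸ prev ∸ 1)) * incSum k j (suc r)   ∎
      drop-offset : ∀ i → (factor r ^ (suc prev ℕ.+ i ∸ prev ∸ 1)) * incSum k (suc prev ℕ.+ i) (suc r)
                        ≈ (factor r ^ i) * incSum k (suc prev ℕ.+ i) (suc r)
      drop-offset i = *-congʳ (≡⇒≈ (cong (factor r ^_) ([1+m+n]∸m∸1≡n prev i)))

    incSum-step : ∀ k prev r → prev < n →
      incSum (suc k) prev r ≈ incSum k (suc prev) (suc r) + factor r * incSum (suc k) (suc prev) r
    incSum-step k prev r prev<n = begin
      incSum (suc k) prev r                                  ≈⟨ incSum-suc k prev r ⟩
      sumTo T (n ∸ prev)                                     ≡⟨ cong (sumTo T) (m<n⇒n∸m≡1+[n∸1+m] prev<n) ⟩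
      T 0 + sumTo (λ i → T (suc i)) (n ∸ suc prev)           ≈⟨ +-cong T0≈ (sumTo-cong (n ∸ suc prev) T[1+i]≈) ⟩
      incSum k (suc prev) (suc r)
        + sumTo (λ i → factor r * ((factor r ^ i) * incSum k (suc (suc prev) ℕ.+ i) (suc r))) (n ∸ suc prev)
                                                             ≈⟨ +-congˡ (sym (*-distribˡ-sumTo (factor r) _ (n ∸ suc prev))) ⟩
      incSum k (suc prev) (suc r)
        + factor r * sumTo (λ i → (factor r ^ i) * incSum k (suc (suc prev) ℕ.+ i) (suc r)) (n ∸ suc prev)
                                                             ≈⟨ +-congˡ (*-congˡ (sym (incSum-suc k (suc prev) r))) ⟩
      incSum k (suc prev) (suc r) + factor r * incSum (suc k) (suc prev) r ∎
      where
      T : ℕ → Carrier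
      T i = (factor r ^ i) * incSum k (suc prev ℕ.+ i) (suc r)
      T0≈ : T 0 ≈ incSum k (suc prev) (suc r)
      T0≈ = trans (*-identityˡ _) (≡⇒≈ (cong (λ j → incSum k j (suc r)) (ℕ.+-identityʳ (suc prev))))
      T[1+i]≈ : ∀ i → T (suc i) ≈ factor r * ((factor r ^ i) * incSum k (suc (suc prev) ℕ.+ i) (suc r))
      T[1+i]≈ i = trans (*-assoc _ _ _)
        (*-congˡ (*-congˡ (≡⇒≈ (cong (λ j → incSum k (suc j) (suc r)) (ℕ.+-suc prev i)))))

    incSum-vanish : ∀ k prev r → n ≤ k ℕ.+ prev → incSum (suc k) prev r ≈ 0#
    incSum-vanish zero prev r n≤prev =
      trans (incSum-suc 0 prev r) (≡⇒≈ (cong (sumTo _) (ℕ.m≤n⇒m∸n≡0 n≤prev)))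
    incSum-vanish (suc k) prev r n≤1+k+prev =
      trans (incSum-suc (suc k) prev r) (sumTo-0# (n ∸ prev) term≈0#)
      where
      term≈0# : ∀ i → (factor r ^ i) * incSum (suc k) (suc prev ℕ.+ i) (suc r) ≈ 0#
      term≈0# i = trans (*-congˡ (incSum-vanish k (suc prev ℕ.+ i) (suc r) n≤k+[1+prev+i])) (zeroʳ _)
        where
        n≤k+[1+prev+i] : n ≤ k ℕ.+ (suc prev ℕ.+ i)
        n≤k+[1+prev+i] = ℕ.≤-trans n≤1+k+prev
          (ℕ.≤-trans (s≤s (ℕ.+-monoʳ-≤ k (ℕ.m≤m+n prev i))) (ℕ.≤-reflexive (≡.sym (ℕ.+-suc k (prev ℕ.+ i)))))

    incSum≈complete : ∀ k m prev r → k ℕ.+ r ≡ d → k ℕ.+ m ℕ.+ prev ≡ n →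
                      incSum k prev r ≈ complete (points x) (suc k) m
    incSum≈complete zero m prev r _ m+prev≡n = begin
      (x ^ (n ∸ prev)) * 1# + 0#    ≈⟨ trans (+-identityʳ _) (*-identityʳ _) ⟩
      x ^ (n ∸ prev)                ≡⟨ cong (x ^_) (≡.trans (cong (_∸ prev) (≡.sym m+prev≡n)) (ℕ.m+n∸n≡m m prev)) ⟩
      x ^ m                         ≈⟨ ^-congˡ (sym (x-0#≈x x)) m ⟩
      points x 0 ^ m                ≈⟨ sym (complete-1 (points x) m) ⟩
      complete (points x) 1 m       ∎
    incSum≈complete (suc k) zero prev r k+r≡d k+prev≡n = begin
      incSum (suc k) prev r
        ≈⟨ incSum-step k prev r (≡.subst (prev <_) k+prev≡n (s≤s (ℕ.m≤n+m prev (k ℕ.+ 0)))) ⟩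
      incSum k (suc prev) (suc r) + factor r * incSum (suc k) (suc prev) r
        ≈⟨ +-cong (incSum≈complete k 0 (suc prev) (suc r) (≡.trans (ℕ.+-suc k r) k+r≡d) (≡.trans (ℕ.+-suc (k ℕ.+ 0) prev) k+prev≡n))
                  (*-congˡ (incSum-vanish k (suc prev) r (ℕ.≤-reflexive n≡k+[1+prev]))) ⟩
      1# + factor r * 0#
        ≈⟨ trans (+-congˡ (zeroʳ _)) (+-identityʳ 1#) ⟩
      1#  ∎
      where
      n≡k+[1+prev] : n ≡ k ℕ.+ suc prev
      n≡k+[1+prev] = ≡.trans (≡.sym k+prev≡n)
        (≡.trans (cong (λ t → suc (t ℕ.+ prev)) (ℕ.+-identityʳ k)) (≡.sym (ℕ.+-suc k prev)))
    incSum≈complete (suc k) (suc m) prev r k+r≡d k+m+prev≡n = begin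
      incSum (suc k) prev r
        ≈⟨ incSum-step k prev r (≡.subst (prev <_) k+m+prev≡n (s≤s (ℕ.m≤n+m prev (k ℕ.+ suc m)))) ⟩
      incSum k (suc prev) (suc r) + factor r * incSum (suc k) (suc prev) r
        ≈⟨ +-cong (incSum≈complete k (suc m) (suc prev) (suc r) (≡.trans (ℕ.+-suc k r) k+r≡d) (≡.trans (ℕ.+-suc _ prev) k+m+prev≡n))
                  (*-cong factor≈point (incSum≈complete (suc k) m (suc prev) r k+r≡d k+m+[1+prev]≡n)) ⟩
      complete (points x) (suc k) (suc m) + points x (suc k) * complete (points x) (suc (suc k)) m
        ≈⟨ sym (complete-last (points x) (suc k) m) ⟩
      complete (points x) (suc (suc k)) (suc m) ∎
      where
      factor≈point : factor r ≈ points x (suc k)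
      factor≈point = ≡⇒≈ (cong (λ t → x - cast t) (≡.trans (cong (_∸ r) (≡.sym k+r≡d)) (ℕ.m+n∸n≡m (suc k) r)))
      k+m+[1+prev]≡n : suc k ℕ.+ m ℕ.+ suc prev ≡ n
      k+m+[1+prev]≡n = ≡.trans
        (cong suc (≡.trans (ℕ.+-suc (k ℕ.+ m) prev) (cong (ℕ._+ prev) (≡.sym (ℕ.+-suc k m)))))
        k+m+prev≡n

    fTerm≡summand : ∀ js → fTerm d n x js ≡ summand 0 0 js
    fTerm≡summand []       = ≡.refl
    fTerm≡summand (j ∷ js) = cong (λ t → (x ^ (n ∸ t)) * prodTerm d x 0 0 (j ∷ js)) (lastℕ≡lastOr j js)

    f≈factorial*complete : d ≤ n → f d n x ≈ cast (d !) * complete (points x) (suc d) (n ∸ d)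
    f≈factorial*complete d≤n = *-congˡ (begin
      sumL (map (fTerm d n x) (incLists d 1 n))   ≡⟨ cong sumL (map-cong fTerm≡summand (incLists d 1 n)) ⟩
      incSum d 0 0                                ≈⟨ incSum≈complete d (n ∸ d) 0 0 (ℕ.+-identityʳ d)
                                                       (≡.trans (ℕ.+-identityʳ _) (ℕ.m+[n∸m]≡n d≤n)) ⟩
      complete (points x) (suc d) (n ∸ d)         ∎)

lemma1 : ∀ {c ℓ : Level} (R : CommutativeRing c ℓ) (n d : ℕ) → 1 ≤ d → d ≤ n →
           (x : CommutativeRing.Carrier R) →
           CommutativeRing._≈_ R (Poly.f R d n x) (Poly.g R d n x)
lemma1 R n d _ d≤n x = begin
  f d n x                                              ≈⟨ f≈factorial*complete R d n x d≤n ⟩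
  cast (d !) * complete R (points R x) (suc d) (n ∸ d) ≈⟨ factorial*complete≈g R d (n ∸ d) x ⟩
  g d (n ∸ d ℕ.+ d) x                                  ≡⟨ cong (λ N → g d N x) (ℕ.m∸n+n≡m d≤n) ⟩
  g d n x                                              ∎
  where
  open CommutativeRing R
  open Poly R
  open import Relation.Binary.Reasoning.Setoid setoid
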